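{- Let $G=(V,E)$ be a finite simple undirected graph, let $k \ge 0$ be an integer, and let $lb$ be an integer with $lb \le \eta(G,k)$. If there exists an edge $\{u,v\} \in E$ such that $\omega(G[N(u) \cap N(v)]) \le lb - 3$, then $\eta(G,k) = \eta((V, E \setminus \{\{u,v\}\}), k)$.
   Context: For a graph $H=(W,D)$, $\omega(H)$ denotes its clique number (size of a largest clique; $0$ for the empty graph). $N(u)$ is the set of neighbours of $u$ in $G$, and $G[S]$ the subgraph of $G$ induced by $S\subseteq V$. For a graph $H=(W,D)$ and integer $k\ge 0$, $\eta(H,k) = \min\{\omega((W, D\setminus F)) : F \subseteq D,\ |F| \le k\}$, the minimum clique number achievable by deleting at most $k$ edges. -}

module Defs where

open import Data.Bool using (Bool; true; false; _∧_; _∨_; not; if_then_else_)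
open import Data.Nat using (ℕ; zero; suc; _⊔_; _⊓_; _≤ᵇ_)
open import Data.Fin using (Fin; zero; suc; _<?_)
open import Data.Fin.Properties using () renaming (_≟_ to _≟ᶠ_)
open import Data.List using (List; []; _∷_; [_]; map; foldr; concatMap; length; allFin; lookup; filterᵇ)
open import Data.Bool.ListAction using (all; any)
open import Data.Vec using (Vec; []; _∷_) renaming (lookup to vlookup)
open import Data.Product using (_×_; _,_)
open import Relation.Nullary.Decidable using (⌊_⌋)

-- A graph on the vertex set Fin n, given by a Boolean adjacency function.
-- "Finite simple undirected" is imposed as hypotheses (symmetry, irreflexivity)
-- in the statement.
Adj : ℕ → Set
Adj n = Fin n → Fin n → Bool

size : ∀ {n} → Vec Bool n → ℕ
size [] = 0
size (true ∷ s) = suc (size s)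
size (false ∷ s) = size s

subsets : (n : ℕ) → List (Vec Bool n)
subsets zero = [ [] ]
subsets (suc n) = concatMap (λ s → (true ∷ s) ∷ (false ∷ s) ∷ []) (subsets n)

isClique : ∀ {n} → Adj n → Vec Bool n → Bool
isClique {n} A S =
  all (λ i → all (λ j → not (vlookup S i ∧ vlookup S j) ∨ ⌊ i ≟ᶠ j ⌋ ∨ A i j)
                 (allFin n))
      (allFin n)

ω : ∀ {n} → Adj n → ℕ
ω {n} A = foldr _⊔_ 0 (map (λ S → if isClique A S then size S else 0) (subsets n))

-- induced subgraph G[S] for S given by a predicate, on the vertex set
-- Fin (number of vertices in S), enumerating S in increasing order
inducedVerts : ∀ {n} → (Fin n → Bool) → List (Fin n)
inducedVerts {n} S = filterᵇ S (allFin n)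

induced : ∀ {n} → Adj n → (S : Fin n → Bool) → Adj (length (inducedVerts S))
induced A S i j = A (lookup (inducedVerts S) i) (lookup (inducedVerts S) j)

N : ∀ {n} → Adj n → Fin n → Fin n → Bool
N A u w = A u w

edges : ∀ {n} → Adj n → List (Fin n × Fin n)
edges {n} A =
  concatMap (λ i → concatMap (λ j → if ⌊ i <? j ⌋ ∧ A i j then [ (i , j) ] else [])
                             (allFin n))
            (allFin n)

-- all sub-lists (subsequences); sub-lists of the duplicate-free edge list are
-- exactly the subsets F of E
sublists : ∀ {a} {X : Set a} → List X → List (List X)
sublists [] = [ [] ]
sublists (x ∷ xs) = concatMap (λ ys → (x ∷ ys) ∷ ys ∷ []) (sublists xs)

removeEdges : ∀ {n} → List (Fin n × Fin n) → Adj n → Adj n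
removeEdges F A i j =
  A i j ∧ not (any (λ { (a , b) → (⌊ a ≟ᶠ i ⌋ ∧ ⌊ b ≟ᶠ j ⌋) ∨ (⌊ a ≟ᶠ j ⌋ ∧ ⌊ b ≟ᶠ i ⌋) }) F)

-- η(G,k) = min { ω((V, E \ F)) : F ⊆ E, |F| ≤ k }.
-- The minimum is taken over a list; ω(G) (the value at F = ∅, which is always
-- admissible) is used as the initial value of the fold.
η : ∀ {n} → Adj n → ℕ → ℕ
η A k = foldr _⊓_ (ω A)
  (map (λ F → if length F ≤ᵇ k then ω (removeEdges F A) else ω A) (sublists (edges A)))

module Submission where

-- Deleting the edge uv never increases η, since every admissible deletion set F of G restricts to one of
-- G − uv.  Conversely, let |F| ≤ k with F ⊆ E(G − uv); then F is admissible for G too, so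
-- ω(G − F) ≥ η(G,k) ≥ lb ≥ ω(G[N(u) ∩ N(v)]) + 3.  A clique of G − F containing both u and v consists of
-- u, v and a clique of the common neighbourhood, so has at most ω(G[N(u) ∩ N(v)]) + 2 vertices.  Hence a
-- maximum clique of G − F misses u or v, so it is still a clique of (G − uv) − F, and
-- ω((G − uv) − F) ≥ ω(G − F) ≥ η(G,k).

open import Defs
open import Data.Bool using (Bool; true; false; _∧_; _∨_; not; if_then_else_; T)
open import Data.Bool.Properties using (T-∧; T-∨; T-≡)
open import Data.Bool.ListAction using (all; any)
open import Data.Empty using (⊥-elim)
open import Data.Fin using (Fin; zero; suc; _<?_)
open import Data.Fin.Properties using () renaming (_≟_ to _≟ᶠ_)
open import Data.Integer using (ℤ; +_; -[1+_]; +≤+) renaming (_≤_ to _≤ℤ_; _-_ to _-ℤ_)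
open import Data.List using (List; []; _∷_; [_]; _++_; map; concatMap; length; allFin; lookup; filterᵇ)
import Data.List as List
open import Data.List.Membership.Propositional using (_∈_; find; lose)
open import Data.List.Membership.Propositional.Properties
  using (∈-allFin; ∈-lookup; ∈-filter⁺; ∈-map⁺; ∈-map⁻; ∈-concatMap⁺; ∈-concatMap⁻; foldr-selective)
open import Data.List.Properties
  using (foldr-preservesᵇ; foldr-preservesᵒ; filter-++; filter-accept; filter-reject; concatMap-cong; tabulate-lookup)
open import Data.List.Relation.Binary.Sublist.Propositional using (_⊆_; []; _∷_; _∷ʳ_; ⊆-trans)
open import Data.List.Relation.Binary.Sublist.Propositional.Properties
  using (filter⁺; filter-⊆; length-mono-≤)
open import Data.List.Relation.Unary.Any using (Any; here; there)
import Data.List.Relation.Unary.Any as Any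
open import Data.List.Relation.Unary.Any.Properties using (any⁺; any⁻)
import Data.List.Relation.Unary.All as All
import Data.List.Relation.Unary.All.Properties as All
open import Data.List.Relation.Unary.AllPairs using (_∷_)
open import Data.List.Relation.Unary.Unique.Propositional using (Unique)
import Data.List.Relation.Unary.Unique.Propositional.Properties as Unique
open import Data.Nat using (ℕ; zero; suc; _+_; _≤_; _⊔_; _⊓_; _≤ᵇ_; z≤n; s≤s)
open import Data.Nat.Properties
  using (≤-refl; ≤-trans; ≤-reflexive; ≤-antisym; <-irrefl; ⊔-sel; ⊓-glb; ≤ᵇ⇒≤; ≤⇒≤ᵇ;
         m≤n⇒m≤n⊔o; m≤n⇒m≤o⊔n; m≤n⇒m⊓o≤n; m≤n⇒o⊓m≤n; module ≤-Reasoning)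
open import Data.Product using (_×_; _,_; proj₁; proj₂; ∃-syntax)
import Data.Sum as Sum
open import Data.Sum using (_⊎_; inj₁; inj₂)
open import Data.Unit using (tt)
open import Data.Vec using (Vec; []; _∷_; replicate; tabulate; _[_]≔_) renaming (lookup to vlookup)
open import Data.Vec.Properties
  using (lookup-replicate; lookup∘tabulate; tabulate∘lookup; lookup∘update; lookup∘update′)
open import Function using (_∘_; id; case_of_; _⇔_; mk⇔; Equivalence)
open import Relation.Binary.PropositionalEquality
  using (_≡_; _≢_; refl; sym; trans; cong; subst; module ≡-Reasoning)
open import Relation.Nullary using (Dec; yes; no; ¬_; contradiction)
open import Relation.Nullary.Decidable using (⌊_⌋; T?; _×-dec_; map′; toWitness; fromWitness)

private variable
  n : ℕ

open Equivalence using (to; from)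

_⊆ᴳ_ : Adj n → Adj n → Set
B ⊆ᴳ A = ∀ {i j} → T (B i j) → T (A i j)

IsClique : Adj n → Vec Bool n → Set
IsClique A S = ∀ {i j} → T (vlookup S i) → T (vlookup S j) → i ≢ j → T (A i j)

IsClique-mono : ∀ {A B : Adj n} S → B ⊆ᴳ A → IsClique B S → IsClique A S
IsClique-mono S B⊆A cl Si Sj i≢j = B⊆A (cl Si Sj i≢j)

emptyClique : (A : Adj n) → IsClique A (replicate n false)
emptyClique A {i} Si = ⊥-elim (subst T (lookup-replicate i false) Si)

module _ {p} {P : Set p} where

  pairCondition⇒ : ∀ {a b c} (d : Dec P) → T (not (a ∧ b) ∨ ⌊ d ⌋ ∨ c) → T a → T b → ¬ P → T c
  pairCondition⇒ {true} {true} (yes p) _ _ _ ¬p = contradiction p ¬p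
  pairCondition⇒ {true} {true} (no _)  h _ _ _  = h

  pairCondition⇐ : ∀ {a b c} (d : Dec P) → (T a → T b → ¬ P → T c) → T (not (a ∧ b) ∨ ⌊ d ⌋ ∨ c)
  pairCondition⇐ {false}        _       _ = tt
  pairCondition⇐ {true} {false} _       _ = tt
  pairCondition⇐ {true} {true}  (yes _) _ = tt
  pairCondition⇐ {true} {true}  (no ¬p) h = h tt tt ¬p

isClique⇔IsClique : (A : Adj n) (S : Vec Bool n) → T (isClique A S) ⇔ IsClique A S
isClique⇔IsClique {n} A S = mk⇔
  (λ h {i} {j} → pairCondition⇒ (i ≟ᶠ j)
     (All.lookup (All.all⁺ (cond i) (allFin n) (All.lookup (All.all⁺ row (allFin n) h) (∈-allFin i)))
                 (∈-allFin j)))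
  (λ cl → All.all⁻ row (All.tabulate {xs = allFin n} λ {i} _ →
            All.all⁻ (cond i) (All.tabulate {xs = allFin n} λ {j} _ →
              pairCondition⇐ (i ≟ᶠ j) (cl {i} {j}))))
  where
  cond : Fin n → Fin n → Bool
  cond i j = not (vlookup S i ∧ vlookup S j) ∨ ⌊ i ≟ᶠ j ⌋ ∨ A i j
  row : Fin n → Bool
  row i = all (cond i) (allFin n)

-- The clique number

∈-subsets : (S : Vec Bool n) → S ∈ subsets n
∈-subsets []      = here refl
∈-subsets (b ∷ S) =
  ∈-concatMap⁺ (λ s → (true ∷ s) ∷ (false ∷ s) ∷ []) (Any.map (λ { refl → extend b }) (∈-subsets S))
  where
  extend : ∀ b → (b ∷ S) ∈ (true ∷ S) ∷ (false ∷ S) ∷ []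
  extend true  = here refl
  extend false = there (here refl)

cliqueSize : Adj n → Vec Bool n → ℕ
cliqueSize A S = if isClique A S then size S else 0

cliqueSize-clique : ∀ {A : Adj n} S → IsClique A S → cliqueSize A S ≡ size S
cliqueSize-clique {A = A} S cl with isClique A S | from (isClique⇔IsClique A S) cl
... | true | _ = refl

clique⇒size≤ω : ∀ {A : Adj n} S → IsClique A S → size S ≤ ω A
clique⇒size≤ω {n} {A} S cl = foldr-preservesᵒ ≤⊔ 0 (map (cliqueSize A) (subsets n))
  (inj₂ (Any.map (λ { refl → ≤-reflexive (sym (cliqueSize-clique S cl)) })
                 (∈-map⁺ (cliqueSize A) (∈-subsets S))))
  where
  ≤⊔ : ∀ x y → size S ≤ x ⊎ size S ≤ y → size S ≤ x ⊔ y
  ≤⊔ x y = Sum.[ m≤n⇒m≤n⊔o y , m≤n⇒m≤o⊔n x ]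

ω-attained : (A : Adj n) → ∃[ S ] IsClique A S × ω A ≤ size S
ω-attained {n} A with foldr-selective ⊔-sel 0 (map (cliqueSize A) (subsets n))
... | inj₁ ω≡0 = replicate n false , emptyClique A , ≤-trans (≤-reflexive ω≡0) z≤n
... | inj₂ ω∈  with ∈-map⁻ (cliqueSize A) ω∈
...   | S , _ , ω≡ with isClique A S in isCl
...     | true  = S , to (isClique⇔IsClique A S) (from T-≡ isCl) , ≤-reflexive ω≡
...     | false = replicate n false , emptyClique A , ≤-trans (≤-reflexive ω≡) z≤n

ω-mono : ∀ {A B : Adj n} → B ⊆ᴳ A → ω B ≤ ω A
ω-mono {B = B} B⊆A with ω-attained B
... | S , cl , ω≤ = ≤-trans ω≤ (clique⇒size≤ω S (IsClique-mono S B⊆A cl))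

length-filterᵇ-tabulate : ∀ {X : Set} {m} (p : X → Bool) (h : Fin m → X) →
  length (filterᵇ p (List.tabulate h)) ≡ size (tabulate (p ∘ h))
length-filterᵇ-tabulate {m = zero}  p h = refl
length-filterᵇ-tabulate {m = suc m} p h with p (h zero)
... | true  = cong suc (length-filterᵇ-tabulate p (h ∘ suc))
... | false = length-filterᵇ-tabulate p (h ∘ suc)

filterᵇ-absorb : ∀ {X : Set} (p q : X → Bool) → (∀ {x} → T (p x) → T (q x)) →
  ∀ xs → filterᵇ p (filterᵇ q xs) ≡ filterᵇ p xs
filterᵇ-absorb p q p⇒q [] = refl
filterᵇ-absorb p q p⇒q (x ∷ xs) with T? (p x) | T? (q x)
... | yes px | _
  rewrite filter-accept (T? ∘ q) {x} {xs} (p⇒q px)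
        | filter-accept (T? ∘ p) {x} {filterᵇ q xs} px
        | filter-accept (T? ∘ p) {x} {xs} px = cong (x ∷_) (filterᵇ-absorb p q p⇒q xs)
... | no ¬px | yes qx
  rewrite filter-accept (T? ∘ q) {x} {xs} qx
        | filter-reject (T? ∘ p) {x} {filterᵇ q xs} ¬px
        | filter-reject (T? ∘ p) {x} {xs} ¬px = filterᵇ-absorb p q p⇒q xs
... | no ¬px | no ¬qx
  rewrite filter-reject (T? ∘ q) {x} {xs} ¬qx
        | filter-reject (T? ∘ p) {x} {xs} ¬px = filterᵇ-absorb p q p⇒q xs

lookup-injective : ∀ {X : Set} {xs : List X} → Unique xs → ∀ {i j} → lookup xs i ≡ lookup xs j → i ≡ j
lookup-injective {xs = _ ∷ _} _            {zero}  {zero}  _ = refl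
lookup-injective {xs = _ ∷ _} (x∉xs ∷ _)   {zero}  {suc j} e = ⊥-elim (All.lookup x∉xs (∈-lookup j) e)
lookup-injective {xs = _ ∷ _} (x∉xs ∷ _)   {suc i} {zero}  e = ⊥-elim (All.lookup x∉xs (∈-lookup i) (sym e))
lookup-injective {xs = _ ∷ _} (_ ∷ unique) {suc i} {suc j} e = cong suc (lookup-injective unique e)

clique⇒size≤ω-induced : ∀ {A : Adj n} (P : Fin n → Bool) S → IsClique A S →
  (∀ {w} → T (vlookup S w) → T (P w)) → size S ≤ ω (induced A P)
clique⇒size≤ω-induced {n} {A} P S cl S⊆P =
  subst (_≤ ω (induced A P)) (sym sizes) (clique⇒size≤ω S′ cl′)
  where
  L  = inducedVerts P
  S′ = tabulate (vlookup S ∘ lookup L)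

  cl′ : IsClique (induced A P) S′
  cl′ {i} {j} S′i S′j i≢j =
    cl (subst T (lookup∘tabulate _ i) S′i) (subst T (lookup∘tabulate _ j) S′j)
       (i≢j ∘ lookup-injective (Unique.filter⁺ (T? ∘ P) (Unique.allFin⁺ n)))

  sizes : size S ≡ size S′
  sizes = begin
    size S                                   ≡⟨ cong size (sym (tabulate∘lookup S)) ⟩
    size (tabulate (vlookup S))              ≡⟨ sym (length-filterᵇ-tabulate (vlookup S) id) ⟩
    length (filterᵇ (vlookup S) (allFin n))  ≡⟨ cong length (filterᵇ-absorb (vlookup S) P S⊆P (allFin n)) ⟨
    length (filterᵇ (vlookup S) L)           ≡⟨ cong (length ∘ filterᵇ (vlookup S)) (tabulate-lookup L) ⟨
    length (filterᵇ (vlookup S) (List.tabulate (lookup L)))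
                                             ≡⟨ length-filterᵇ-tabulate (vlookup S) (lookup L) ⟩
    size S′                                  ∎
    where open ≡-Reasoning

_≈ᵉ_ : Fin n × Fin n → Fin n × Fin n → Set
(a , b) ≈ᵉ (i , j) = (a ≡ i × b ≡ j) ⊎ (a ≡ j × b ≡ i)

≈ᵉ-trans : ∀ {e f g : Fin n × Fin n} → e ≈ᵉ f → f ≈ᵉ g → e ≈ᵉ g
≈ᵉ-trans (inj₁ (refl , refl)) f≈g                  = f≈g
≈ᵉ-trans (inj₂ (refl , refl)) (inj₁ (refl , refl)) = inj₂ (refl , refl)
≈ᵉ-trans (inj₂ (refl , refl)) (inj₂ (refl , refl)) = inj₁ (refl , refl)

sameEdge? : Fin n × Fin n → Fin n × Fin n → Bool
sameEdge? (a , b) (i , j) = (⌊ a ≟ᶠ i ⌋ ∧ ⌊ b ≟ᶠ j ⌋) ∨ (⌊ a ≟ᶠ j ⌋ ∧ ⌊ b ≟ᶠ i ⌋)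

T-sameEdge? : ∀ (e f : Fin n × Fin n) → T (sameEdge? e f) ⇔ e ≈ᵉ f
T-sameEdge? (a , b) (i , j) = mk⇔
  (Sum.map witnesses witnesses ∘ to T-∨)
  (from T-∨ ∘ Sum.map unwitnesses unwitnesses)
  where
  witnesses : ∀ {c d e f : Fin _} → T (⌊ c ≟ᶠ d ⌋ ∧ ⌊ e ≟ᶠ f ⌋) → c ≡ d × e ≡ f
  witnesses {c} {d} {e} {f} t =
    let p , q = to (T-∧ {⌊ c ≟ᶠ d ⌋}) t in toWitness {a? = c ≟ᶠ d} p , toWitness {a? = e ≟ᶠ f} q
  unwitnesses : ∀ {c d e f : Fin _} → c ≡ d × e ≡ f → T (⌊ c ≟ᶠ d ⌋ ∧ ⌊ e ≟ᶠ f ⌋)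
  unwitnesses {c} {d} {e} {f} (p , q) =
    from (T-∧ {⌊ c ≟ᶠ d ⌋}) (fromWitness {a? = c ≟ᶠ d} p , fromWitness {a? = e ≟ᶠ f} q)

avoids : List (Fin n × Fin n) → Fin n × Fin n → Bool
avoids F e = not (any (λ f → sameEdge? f e) F)

T-not : ∀ {b} → T (not b) ⇔ (¬ T b)
T-not {false} = mk⇔ (λ _ ()) (λ _ → tt)
T-not {true}  = mk⇔ (λ ()) (λ ¬T → ¬T tt)

T-avoids : ∀ F (e : Fin n × Fin n) → T (avoids F e) ⇔ (¬ Any (_≈ᵉ e) F)
T-avoids F e = mk⇔
  (λ t F∋e → to T-not t (any⁺ _ (Any.map (from (T-sameEdge? _ e)) F∋e)))
  (λ ¬F∋e → from T-not λ t → ¬F∋e (Any.map (to (T-sameEdge? _ e)) (any⁻ _ F t)))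

T-removeEdges : ∀ F (A : Adj n) {i j} → T (removeEdges F A i j) ⇔ (T (A i j) × T (avoids F (i , j)))
T-removeEdges F A = T-∧

removeEdges-⊆ᴳ : ∀ F (A : Adj n) → removeEdges F A ⊆ᴳ A
removeEdges-⊆ᴳ F A = proj₁ ∘ to (T-removeEdges F A)

removeEdge-keeps-others : ∀ (A : Adj n) e {i j} →
  T (A i j) → ¬ e ≈ᵉ (i , j) → T (removeEdges [ e ] A i j)
removeEdge-keeps-others A e Aij e≉ij =
  from (T-removeEdges [ e ] A) (Aij , from (T-avoids [ e ] _) λ { (here e≈ij) → e≉ij e≈ij })

removeEdges-keeps-others : ∀ F (A : Adj n) e {i j} →
  T (removeEdges F A i j) → ¬ e ≈ᵉ (i , j) → T (removeEdges F (removeEdges [ e ] A) i j)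
removeEdges-keeps-others F A e h e≉ij =
  let Aij , Fij = to (T-removeEdges F A) h
  in from (T-removeEdges F (removeEdges [ e ] A)) (removeEdge-keeps-others A e Aij e≉ij , Fij)

-- Cliques through an edge

size-remove : ∀ (S : Vec Bool n) {w} → T (vlookup S w) → size S ≡ suc (size (S [ w ]≔ false))
size-remove (true  ∷ S) {zero}  _  = refl
size-remove (true  ∷ S) {suc w} Sw = cong suc (size-remove S Sw)
size-remove (false ∷ S) {suc w} Sw = size-remove S Sw

∈-remove⁻ : ∀ (S : Vec Bool n) {x w} → T (vlookup (S [ x ]≔ false) w) → w ≢ x × T (vlookup S w)
∈-remove⁻ S {x} {w} Sw with w ≟ᶠ x
... | yes refl = ⊥-elim (subst T (lookup∘update w S false) Sw)
... | no w≢x   = w≢x , subst T (lookup∘update′ w≢x S false) Sw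

commonNeighbours : Adj n → Fin n → Fin n → Fin n → Bool
commonNeighbours A u v w = N A u w ∧ N A v w

size≤2+ω-commonNeighbours : ∀ {A : Adj n} {u v} S → IsClique A S → u ≢ v →
  T (vlookup S u) → T (vlookup S v) → size S ≤ 2 + ω (induced A (commonNeighbours A u v))
size≤2+ω-commonNeighbours {A = A} {u} {v} S cl u≢v Su Sv = begin
  size S        ≡⟨ size-remove S Su ⟩
  suc (size S₁) ≡⟨ cong suc (size-remove S₁ (subst T (sym (lookup∘update′ (u≢v ∘ sym) S false)) Sv)) ⟩
  2 + size S₂   ≤⟨ s≤s (s≤s (clique⇒size≤ω-induced (commonNeighbours A u v) S₂ cl₂ common)) ⟩
  2 + ω (induced A (commonNeighbours A u v)) ∎
  where
  open ≤-Reasoning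
  S₁ = S [ u ]≔ false
  S₂ = S₁ [ v ]≔ false

  ∈S₂⁻ : ∀ {w} → T (vlookup S₂ w) → w ≢ u × w ≢ v × T (vlookup S w)
  ∈S₂⁻ S₂w = let w≢v , S₁w = ∈-remove⁻ S₁ S₂w; w≢u , Sw = ∈-remove⁻ S S₁w in w≢u , w≢v , Sw

  cl₂ : IsClique A S₂
  cl₂ S₂i S₂j = cl (proj₂ (proj₂ (∈S₂⁻ S₂i))) (proj₂ (proj₂ (∈S₂⁻ S₂j)))

  common : ∀ {w} → T (vlookup S₂ w) → T (commonNeighbours A u v w)
  common S₂w = let w≢u , w≢v , Sw = ∈S₂⁻ S₂w in
    from T-∧ (cl Su Sw (w≢u ∘ sym) , cl Sv Sw (w≢v ∘ sym))

≈ᵉ-members : ∀ (S : Vec Bool n) {u v i j} → (u , v) ≈ᵉ (i , j) →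
  T (vlookup S i) → T (vlookup S j) → T (vlookup S u) × T (vlookup S v)
≈ᵉ-members S (inj₁ (refl , refl)) Si Sj = Si , Sj
≈ᵉ-members S (inj₂ (refl , refl)) Si Sj = Sj , Si

ω-preserved-off-edge : ∀ {A B B′ : Adj n} {u v} → B ⊆ᴳ A → u ≢ v →
  (∀ {i j} → T (B i j) → ¬ (u , v) ≈ᵉ (i , j) → T (B′ i j)) →
  3 + ω (induced A (commonNeighbours A u v)) ≤ ω B → ω B ≤ ω B′
ω-preserved-off-edge {B = B} {u = u} {v} B⊆A u≢v keep large with ω-attained B
... | S , cl , ω≤S with T? (vlookup S u) ×-dec T? (vlookup S v)
... | yes (Su , Sv) = contradiction
        (≤-trans large (≤-trans ω≤S (size≤2+ω-commonNeighbours S (IsClique-mono S B⊆A cl) u≢v Su Sv)))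
        (<-irrefl refl)
... | no ¬SuSv = ≤-trans ω≤S
        (clique⇒size≤ω S λ Si Sj i≢j → keep (cl Si Sj i≢j) (¬SuSv ∘ λ uv≈ij → ≈ᵉ-members S uv≈ij Si Sj))

filterᵇ-concatMap : ∀ {X Y : Set} (p : Y → Bool) (f : X → List Y) xs →
  filterᵇ p (concatMap f xs) ≡ concatMap (filterᵇ p ∘ f) xs
filterᵇ-concatMap p f []       = refl
filterᵇ-concatMap p f (x ∷ xs) =
  trans (filter-++ (T? ∘ p) (f x) (concatMap f xs)) (cong (filterᵇ p (f x) ++_) (filterᵇ-concatMap p f xs))

filterᵇ-if : ∀ {X : Set} (p : X → Bool) c a x →
  filterᵇ p (if c ∧ a then [ x ] else []) ≡ (if c ∧ (a ∧ p x) then [ x ] else [])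
filterᵇ-if p false a     x = refl
filterᵇ-if p true  false x = refl
filterᵇ-if p true  true  x with p x
... | true  = refl
... | false = refl

edges-∧ : ∀ (A : Adj n) (q : Fin n × Fin n → Bool) → edges (λ i j → A i j ∧ q (i , j)) ≡ filterᵇ q (edges A)
edges-∧ {n} A q = sym (trans (filterᵇ-concatMap q _ (allFin n)) (concatMap-cong (λ i →
  trans (filterᵇ-concatMap q _ (allFin n)) (concatMap-cong (λ j →
    filterᵇ-if q ⌊ i <? j ⌋ (A i j) (i , j)) (allFin n))) (allFin n)))

edges-removeEdges : ∀ F (A : Adj n) → edges (removeEdges F A) ≡ filterᵇ (avoids F) (edges A)
edges-removeEdges F A = edges-∧ A (avoids F)

edges-removeEdges-⊆ : ∀ F (A : Adj n) → edges (removeEdges F A) ⊆ edges A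
edges-removeEdges-⊆ F A =
  subst (_⊆ edges A) (sym (edges-removeEdges F A)) (filter-⊆ (T? ∘ avoids F) (edges A))

∈-sublists⇔⊆ : ∀ {X : Set} (xs ys : List X) → ys ∈ sublists xs ⇔ ys ⊆ xs
∈-sublists⇔⊆ xs ys = mk⇔ (∈-sublists⁻ xs) (∈-sublists⁺ xs)
  where
  extensions : ∀ {X : Set} → X → List X → List (List X)
  extensions x zs = (x ∷ zs) ∷ zs ∷ []

  ∈-sublists⁻ : ∀ {X : Set} (xs : List X) {ys} → ys ∈ sublists xs → ys ⊆ xs
  ∈-sublists⁻ []       (here refl) = []
  ∈-sublists⁻ (x ∷ xs) ys∈ with find (∈-concatMap⁻ (extensions x) ys∈)
  ... | zs , zs∈ , here refl         = refl ∷ ∈-sublists⁻ xs zs∈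
  ... | zs , zs∈ , there (here refl) = x ∷ʳ ∈-sublists⁻ xs zs∈

  ∈-sublists⁺ : ∀ {X : Set} (xs : List X) {ys} → ys ⊆ xs → ys ∈ sublists xs
  ∈-sublists⁺ []       []         = here refl
  ∈-sublists⁺ (x ∷ xs) (refl ∷ p) = ∈-concatMap⁺ (extensions x) (lose (∈-sublists⁺ xs p) (here refl))
  ∈-sublists⁺ (x ∷ xs) (.x ∷ʳ p)  = ∈-concatMap⁺ (extensions x) (lose (∈-sublists⁺ xs p) (there (here refl)))

-- The deletion number η

admissibleValue : Adj n → ℕ → List (Fin n × Fin n) → ℕ
admissibleValue A k F = if length F ≤ᵇ k then ω (removeEdges F A) else ω A

admissibleValue-≤ : ∀ (A : Adj n) {k F} → length F ≤ k → admissibleValue A k F ≡ ω (removeEdges F A)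
admissibleValue-≤ A {k} {F} |F|≤k with length F ≤ᵇ k | ≤⇒≤ᵇ |F|≤k
... | true | _ = refl

⊓≤ : ∀ {v} x y → x ≤ v ⊎ y ≤ v → x ⊓ y ≤ v
⊓≤ x y = Sum.[ m≤n⇒m⊓o≤n y , m≤n⇒o⊓m≤n x ]

η≤ : ∀ (A : Adj n) k {v} → ω A ≤ v ⊎ Any (_≤ v) (map (admissibleValue A k) (sublists (edges A))) → η A k ≤ v
η≤ A k = foldr-preservesᵒ ⊓≤ (ω A) (map (admissibleValue A k) (sublists (edges A)))

η≤ω : ∀ (A : Adj n) k → η A k ≤ ω A
η≤ω A k = η≤ A k (inj₁ ≤-refl)

η≤ω-removeEdges : ∀ (A : Adj n) k {F} → F ⊆ edges A → length F ≤ k → η A k ≤ ω (removeEdges F A)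
η≤ω-removeEdges A k {F} F⊆E |F|≤k = η≤ A k
  (inj₂ (Any.map (λ { refl → ≤-reflexive (admissibleValue-≤ A {k} {F} |F|≤k) })
                 (∈-map⁺ (admissibleValue A k) (from (∈-sublists⇔⊆ (edges A) F) F⊆E))))

η-glb : ∀ (A : Adj n) k {m} → m ≤ ω A →
  (∀ {F} → F ⊆ edges A → length F ≤ k → m ≤ ω (removeEdges F A)) → m ≤ η A k
η-glb A k {m} m≤ω m≤ωF = foldr-preservesᵇ {P = m ≤_} {f = _⊓_} ⊓-glb m≤ω
  (All.map⁺ {f = admissibleValue A k}
    (All.tabulate λ {F} F∈ → m≤admissible F (to (∈-sublists⇔⊆ (edges A) F) F∈)))
  where
  m≤admissible : ∀ F → F ⊆ edges A → m ≤ admissibleValue A k F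
  m≤admissible F F⊆E with length F ≤ᵇ k in le
  ... | true  = m≤ωF F⊆E (≤ᵇ⇒≤ (length F) k (from T-≡ le))
  ... | false = m≤ω

-- Deleting an edge

_≈ᵉ?_ : ∀ (e f : Fin n × Fin n) → Dec (e ≈ᵉ f)
e ≈ᵉ? f = map′ (to (T-sameEdge? e f)) (from (T-sameEdge? e f)) (T? (sameEdge? e f))

avoids-filterᵇ : ∀ G F (e : Fin n × Fin n) →
  T (avoids G e) → T (avoids (filterᵇ (avoids G) F) e) → T (avoids F e)
avoids-filterᵇ G F e Ge F′e = from (T-avoids F e) λ F∋e →
  let f , f∈F , f≈e = find F∋e in
  case Any.any? (_≈ᵉ? f) G of λ where
    (yes G∋f) → to (T-avoids G e) Ge (Any.map (λ g≈f → ≈ᵉ-trans g≈f f≈e) G∋f)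
    (no ¬G∋f) → to (T-avoids (filterᵇ (avoids G) F) e) F′e
                   (lose (∈-filter⁺ (T? ∘ avoids G) f∈F (from (T-avoids G f) ¬G∋f)) f≈e)

removeEdges-filterᵇ-⊆ᴳ : ∀ G F (A : Adj n) →
  removeEdges (filterᵇ (avoids G) F) (removeEdges G A) ⊆ᴳ removeEdges F A
removeEdges-filterᵇ-⊆ᴳ G F A h =
  let AGij , F′ij = to (T-removeEdges (filterᵇ (avoids G) F) (removeEdges G A)) h
      Aij , Gij   = to (T-removeEdges G A) AGij
  in from (T-removeEdges F A) (Aij , avoids-filterᵇ G F _ Gij F′ij)

η-removeEdges-≤ : ∀ G (A : Adj n) k → η (removeEdges G A) k ≤ η A k
η-removeEdges-≤ G A k =
  η-glb A k (≤-trans (η≤ω A′ k) (ω-mono {A = A} {A′} (removeEdges-⊆ᴳ G A))) λ {F} F⊆E |F|≤k →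
  ≤-trans (η≤ω-removeEdges A′ k (F′⊆E′ F⊆E) (≤-trans (length-mono-≤ (filter-⊆ (T? ∘ avoids G) F)) |F|≤k))
          (ω-mono {A = removeEdges F A} (removeEdges-filterᵇ-⊆ᴳ G F A))
  where
  A′ = removeEdges G A
  F′⊆E′ : ∀ {F} → F ⊆ edges A → filterᵇ (avoids G) F ⊆ edges A′
  F′⊆E′ F⊆E = subst (_ ⊆_) (sym (edges-removeEdges G A))
                (filter⁺ (T? ∘ avoids G) (T? ∘ avoids G) (λ { refl p → p }) F⊆E)

η≤η-removeEdge : ∀ (A : Adj n) k {u v} → u ≢ v → 3 + ω (induced A (commonNeighbours A u v)) ≤ η A k →
  η A k ≤ η (removeEdges [ (u , v) ] A) k
η≤η-removeEdge A k {u} {v} u≢v large = η-glb A′ k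
  (≤-trans (η≤ω A k)
     (ω-preserved-off-edge id u≢v (removeEdge-keeps-others A (u , v)) (≤-trans large (η≤ω A k))))
  λ {F} F⊆E′ |F|≤k →
    let η≤ωF = η≤ω-removeEdges A k (⊆-trans F⊆E′ (edges-removeEdges-⊆ [ (u , v) ] A)) |F|≤k
    in ≤-trans η≤ωF (ω-preserved-off-edge (removeEdges-⊆ᴳ F A) u≢v
                       (removeEdges-keeps-others F A (u , v)) (≤-trans large η≤ωF))
  where
  A′ = removeEdges [ (u , v) ] A

3+≤-from-lb : ∀ (lb : ℤ) {m c} → lb ≤ℤ + m → + c ≤ℤ lb -ℤ + 3 → 3 + c ≤ m
3+≤-from-lb (+ suc (suc (suc lb))) (+≤+ lb≤m) (+≤+ c≤lb) = ≤-trans (s≤s (s≤s (s≤s c≤lb))) lb≤m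
3+≤-from-lb (+ 0)      _ ()
3+≤-from-lb (+ 1)      _ ()
3+≤-from-lb (+ 2)      _ ()
3+≤-from-lb -[1+ _ ]   _ ()

lemma3 : (n : ℕ) (A : Adj n) →
    (∀ i j → A i j ≡ A j i) →
    (∀ i → A i i ≡ false) →
    (k : ℕ) (lb : ℤ) →
    lb ≤ℤ + η A k →
    (u v : Fin n) → A u v ≡ true →
    + ω (induced A (λ w → N A u w ∧ N A v w)) ≤ℤ lb -ℤ + 3 →
    η A k ≡ η (removeEdges [ (u , v) ] A) k
lemma3 n A _ irreflexive k lb lb≤η u v Auv ω≤lb-3 =
  ≤-antisym (η≤η-removeEdge A k u≢v (3+≤-from-lb lb lb≤η ω≤lb-3)) (η-removeEdges-≤ [ (u , v) ] A k)
  where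
  u≢v : u ≢ v
  u≢v refl = contradiction (trans (sym Auv) (irreflexive u)) λ ()
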